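{- Let $S$ be a left exact semiring. Then there exists an element $e\in S$ such that $1+1+e=1$.
   Context: A semiring is a set $S$ with binary operations $+$ and $\cdot$ such that $(S,+)$ is a commutative monoid with identity $0$, $(S,\cdot)$ is a monoid with identity $1$, multiplication distributes over addition from both sides, $0x=x0=0$ for all $x\in S$, and $0\neq 1$ (additive inverses not required; multiplication need not be commutative). $S^n$ is a left $S$-semimodule via $\lambda(s_1,\dots,s_n)=(\lambda s_1,\dots,\lambda s_n)$. A map $\varphi:L\to S$ on a left subsemimodule $L\subseteq S^n$ is left $S$-linear if $\varphi(x+y)=\varphi(x)+\varphi(y)$ and $\varphi(\lambda x)=\lambda\varphi(x)$. $S$ is left exact if for every $n$, every finitely generated left subsemimodule $L\subseteq S^n$ and every left $S$-linear $\varphi:L\to S$ there is a left $S$-linear $\varphi_0:S^n\to S$ agreeing with $\varphi$ on $L$. -}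

module Defs where

open import Level using (Level; _⊔_)
open import Data.Nat using (ℕ)
open import Data.Fin using (Fin)
open import Data.Product using (Σ; ∃; _×_; _,_; proj₁)
open import Relation.Nullary using (¬_)
open import Algebra.Bundles using (Semiring)

module _ {c ℓ : Level} (S : Semiring c ℓ) where
  open Semiring S

  Vecⁿ : ℕ → Set c
  Vecⁿ n = Fin n → Carrier

  _≋_ : {n : ℕ} → Vecⁿ n → Vecⁿ n → Set ℓ
  u ≋ v = ∀ i → u i ≈ v i

  _⊕_ : {n : ℕ} → Vecⁿ n → Vecⁿ n → Vecⁿ n
  (u ⊕ v) i = u i + v i

  _⊛_ : {n : ℕ} → Carrier → Vecⁿ n → Vecⁿ n
  (a ⊛ v) i = a * v i

  ∑ : (k : ℕ) → (Fin k → Carrier) → Carrier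
  ∑ ℕ.zero f = 0#
  ∑ (ℕ.suc k) f = f Fin.zero + ∑ k (λ j → f (Fin.suc j))

  lincomb : {n k : ℕ} → (Fin k → Vecⁿ n) → (Fin k → Carrier) → Vecⁿ n
  lincomb {k = k} g a i = ∑ k (λ j → a j * g j i)

  _∈Span_ : {n k : ℕ} → Vecⁿ n → (Fin k → Vecⁿ n) → Set (c ⊔ ℓ)
  _∈Span_ {k = k} x g = Σ (Fin k → Carrier) λ a → x ≋ lincomb g a

  record IsLeftLinearOnSpan {n k : ℕ} (g : Fin k → Vecⁿ n)
           (φ : (x : Vecⁿ n) → x ∈Span g → Carrier) : Set (c ⊔ ℓ) where
    field
      φ-cong : ∀ x y (px : x ∈Span g) (py : y ∈Span g) → x ≋ y → φ x px ≈ φ y py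
      φ-+    : ∀ x y (px : x ∈Span g) (py : y ∈Span g) (pxy : (x ⊕ y) ∈Span g) →
               φ (x ⊕ y) pxy ≈ φ x px + φ y py
      φ-*    : ∀ a x (px : x ∈Span g) (pax : (a ⊛ x) ∈Span g) →
               φ (a ⊛ x) pax ≈ a * φ x px

  record IsLeftLinear {n : ℕ} (φ₀ : Vecⁿ n → Carrier) : Set (c ⊔ ℓ) where
    field
      cong₀ : ∀ x y → x ≋ y → φ₀ x ≈ φ₀ y
      +₀    : ∀ x y → φ₀ (x ⊕ y) ≈ φ₀ x + φ₀ y
      *₀    : ∀ a x → φ₀ (a ⊛ x) ≈ a * φ₀ x

  LeftExact : Set (c ⊔ ℓ)
  LeftExact = ∀ (n k : ℕ) (g : Fin k → Vecⁿ n)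
                (φ : (x : Vecⁿ n) → x ∈Span g → Carrier) →
                IsLeftLinearOnSpan g φ →
                Σ (Vecⁿ n → Carrier) λ φ₀ →
                  IsLeftLinear φ₀ × (∀ x (px : x ∈Span g) → φ₀ x ≈ φ x px)

-- Let g₀ = (1,1,1), g₁ = (1,0,0), g₂ = (0,1,0) generate L ⊆ S³. Sending
-- λ₀g₀ + λ₁g₁ + λ₂g₂ to λ₀ + λ₁ + λ₂ is well defined on L: in a ring it is
-- x + y − z, and equal coordinates (λ₀ + λ₁, λ₀ + λ₂, λ₀) force equal sums
-- without any subtraction. It is left linear, so left exactness extends it to
-- φ₀ : S³ → S with φ₀ gⱼ = 1 for every j. For e = φ₀ (0,0,1),
--   1 = φ₀ g₀ = φ₀ (g₁ + g₂ + (0,0,1)) = 1 + 1 + e.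
module Submission where

open import Defs
open import Level using (Level)
open import Data.Nat using (zero; suc)
open import Data.Fin using (Fin; zero; suc)
open import Data.Fin.Patterns using (0F; 1F; 2F)
open import Data.Product using (∃; _,_)
open import Data.Vec.Functional using ([]; _∷_)
open import Relation.Nullary using (¬_)
open import Relation.Binary.PropositionalEquality as ≡ using (_≡_)
open import Algebra.Bundles using (CommutativeSemigroup; Semiring)
import Algebra.Properties.CommutativeSemigroup as CommutativeSemigroupProperties
import Algebra.Properties.Semiring.Sum as SemiringSum
import Relation.Binary.Reasoning.Setoid as SetoidReasoning

module _ {a ℓ : Level} (M : CommutativeSemigroup a ℓ) where
  open CommutativeSemigroup M
  open CommutativeSemigroupProperties M using (x∙yz≈y∙xz; xy∙z≈y∙xz)
  open SetoidReasoning setoid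

  ∙-cong-via-partials : ∀ {u₀ u₁ u₂ v₀ v₁ v₂} → u₀ ≈ v₀ →
                        u₀ ∙ u₁ ≈ v₀ ∙ v₁ → u₀ ∙ u₂ ≈ v₀ ∙ v₂ →
                        u₀ ∙ (u₁ ∙ u₂) ≈ v₀ ∙ (v₁ ∙ v₂)
  ∙-cong-via-partials {u₀} {u₁} {u₂} {v₀} {v₁} {v₂} e₀ e₁ e₂ = begin
    u₀ ∙ (u₁ ∙ u₂)   ≈⟨ assoc u₀ u₁ u₂ ⟨
    (u₀ ∙ u₁) ∙ u₂   ≈⟨ ∙-congʳ e₁ ⟩
    (v₀ ∙ v₁) ∙ u₂   ≈⟨ xy∙z≈y∙xz v₀ v₁ u₂ ⟩
    v₁ ∙ (v₀ ∙ u₂)   ≈⟨ ∙-congˡ (∙-congʳ e₀) ⟨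
    v₁ ∙ (u₀ ∙ u₂)   ≈⟨ ∙-congˡ e₂ ⟩
    v₁ ∙ (v₀ ∙ v₂)   ≈⟨ x∙yz≈y∙xz v₁ v₀ v₂ ⟩
    v₀ ∙ (v₁ ∙ v₂)   ∎

module _ {c ℓ : Level} (S : Semiring c ℓ) where
  open Semiring S hiding (zero)
  open SemiringSum S using (sum; sum-cong-≋; ∑-distrib-+; *-distribˡ-sum; sum-replicate-zero)
  open SetoidReasoning setoid

  ∑≡sum : ∀ k (f : Fin k → Carrier) → ∑ S k f ≡ sum f
  ∑≡sum zero    f = ≡.refl
  ∑≡sum (suc k) f = ≡.cong (f zero +_) (∑≡sum k (λ j → f (suc j)))

  ∑-cong : ∀ k {f h : Fin k → Carrier} → (∀ j → f j ≈ h j) → ∑ S k f ≈ ∑ S k h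
  ∑-cong k {f} {h} f≈h = begin
    ∑ S k f ≡⟨ ∑≡sum k f ⟩
    sum f   ≈⟨ sum-cong-≋ f≈h ⟩
    sum h   ≡⟨ ∑≡sum k h ⟨
    ∑ S k h ∎

  ∑-zero : ∀ k → ∑ S k (λ _ → 0#) ≈ 0#
  ∑-zero k = trans (reflexive (∑≡sum k _)) (sum-replicate-zero k)

  ∑-distrib-⊕ : ∀ k (f h : Fin k → Carrier) → ∑ S k (_⊕_ S f h) ≈ ∑ S k f + ∑ S k h
  ∑-distrib-⊕ k f h = begin
    ∑ S k (_⊕_ S f h)   ≡⟨ ∑≡sum k _ ⟩
    sum (_⊕_ S f h)     ≈⟨ ∑-distrib-+ f h ⟩
    sum f + sum h       ≡⟨ ≡.cong₂ _+_ (∑≡sum k f) (∑≡sum k h) ⟨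
    ∑ S k f + ∑ S k h   ∎

  *-distribˡ-∑ : ∀ k s (f : Fin k → Carrier) → s * ∑ S k f ≈ ∑ S k (_⊛_ S s f)
  *-distribˡ-∑ k s f = begin
    s * ∑ S k f       ≡⟨ ≡.cong (s *_) (∑≡sum k f) ⟩
    s * sum f         ≈⟨ *-distribˡ-sum s f ⟩
    sum (_⊛_ S s f)   ≡⟨ ∑≡sum k _ ⟨
    ∑ S k (_⊛_ S s f) ∎

  δ : ∀ {k} → Fin k → Fin k → Carrier
  δ zero    zero    = 1#
  δ zero    (suc _) = 0#
  δ (suc _) zero    = 0#
  δ (suc i) (suc j) = δ i j

  ∑-δ-* : ∀ {k} (i : Fin k) (f : Fin k → Carrier) → ∑ S k (λ j → δ i j * f j) ≈ f i
  ∑-δ-* {suc k} zero f = begin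
    1# * f zero + ∑ S k (λ j → 0# * f (suc j)) ≈⟨ +-cong (*-identityˡ _) (∑-cong k (λ j → zeroˡ (f (suc j)))) ⟩
    f zero + ∑ S k (λ _ → 0#)                  ≈⟨ +-congˡ (∑-zero k) ⟩
    f zero + 0#                                ≈⟨ +-identityʳ _ ⟩
    f zero                                     ∎
  ∑-δ-* {suc k} (suc i) f = begin
    0# * f zero + ∑ S k (λ j → δ i j * f (suc j)) ≈⟨ +-cong (zeroˡ _) (∑-δ-* i (λ j → f (suc j))) ⟩
    0# + f (suc i)                                ≈⟨ +-identityˡ _ ⟩
    f (suc i)                                     ∎

  ∑-δ : ∀ {k} (i : Fin k) → ∑ S k (δ i) ≈ 1#
  ∑-δ {k} i = begin
    ∑ S k (δ i)                ≈⟨ ∑-cong k (λ j → *-identityʳ (δ i j)) ⟨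
    ∑ S k (λ j → δ i j * 1#)   ≈⟨ ∑-δ-* i (λ _ → 1#) ⟩
    1#                         ∎

  lincomb-⊕ : ∀ {n k} (g : Fin k → Vecⁿ S n) (a b : Vecⁿ S k) →
              _≋_ S (lincomb S g (_⊕_ S a b)) (_⊕_ S (lincomb S g a) (lincomb S g b))
  lincomb-⊕ {k = k} g a b i =
    trans (∑-cong k (λ j → distribʳ (g j i) (a j) (b j))) (∑-distrib-⊕ k _ _)

  lincomb-⊛ : ∀ {n k} (g : Fin k → Vecⁿ S n) s (a : Vecⁿ S k) →
              _≋_ S (lincomb S g (_⊛_ S s a)) (_⊛_ S s (lincomb S g a))
  lincomb-⊛ {k = k} g s a i =
    trans (∑-cong k (λ j → *-assoc s (a j) (g j i))) (sym (*-distribˡ-∑ k s _))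

  generator∈Span : ∀ {n k} (g : Fin k → Vecⁿ S n) j → _∈Span_ S (g j) g
  generator∈Span g j = δ j , λ i → sym (∑-δ-* j (λ j′ → g j′ i))

  viaCoefficients : ∀ {n k} (g : Fin k → Vecⁿ S n) → (Vecⁿ S k → Carrier) →
                    (x : Vecⁿ S n) → _∈Span_ S x g → Carrier
  viaCoefficients g ψ x (a , _) = ψ a

  viaCoefficients-isLeftLinearOnSpan :
    ∀ {n k} (g : Fin k → Vecⁿ S n) (ψ : Vecⁿ S k → Carrier) →
    (∀ a b → _≋_ S (lincomb S g a) (lincomb S g b) → ψ a ≈ ψ b) →
    (∀ a b → ψ (_⊕_ S a b) ≈ ψ a + ψ b) →
    (∀ s a → ψ (_⊛_ S s a) ≈ s * ψ a) →
    IsLeftLinearOnSpan S g (viaCoefficients g ψ)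
  viaCoefficients-isLeftLinearOnSpan g ψ ψ-wd ψ-⊕ ψ-⊛ = record
    { φ-cong = λ { x y (a , x≋ga) (b , y≋gb) x≋y →
        ψ-wd a b (λ i → trans (sym (x≋ga i)) (trans (x≋y i) (y≋gb i))) }
    ; φ-+ = λ { x y (a , x≋ga) (b , y≋gb) (d , x⊕y≋gd) →
        trans (ψ-wd d (_⊕_ S a b) λ i → begin
                 lincomb S g d i                        ≈⟨ x⊕y≋gd i ⟨
                 x i + y i                              ≈⟨ +-cong (x≋ga i) (y≋gb i) ⟩
                 lincomb S g a i + lincomb S g b i      ≈⟨ lincomb-⊕ g a b i ⟨
                 lincomb S g (_⊕_ S a b) i              ∎)
              (ψ-⊕ a b) }
    ; φ-* = λ { s x (a , x≋ga) (d , s⊛x≋gd) →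
        trans (ψ-wd d (_⊛_ S s a) λ i → begin
                 lincomb S g d i                        ≈⟨ s⊛x≋gd i ⟨
                 s * x i                                ≈⟨ *-congˡ (x≋ga i) ⟩
                 s * lincomb S g a i                    ≈⟨ lincomb-⊛ g s a i ⟨
                 lincomb S g (_⊛_ S s a) i              ∎)
              (ψ-⊛ s a) }
    }

  generators : Fin 3 → Vecⁿ S 3
  generators = (1# ∷ 1# ∷ 1# ∷ []) ∷ (1# ∷ 0# ∷ 0# ∷ []) ∷ (0# ∷ 1# ∷ 0# ∷ []) ∷ []

  lincomb-generators : ∀ a →
    _≋_ S (lincomb S generators a) ((a 0F + a 1F) ∷ (a 0F + a 2F) ∷ a 0F ∷ [])
  lincomb-generators a 0F = begin
    a 0F * 1# + (a 1F * 1# + (a 2F * 0# + 0#))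
      ≈⟨ +-cong (*-identityʳ _) (+-cong (*-identityʳ _) (trans (+-identityʳ _) (zeroʳ _))) ⟩
    a 0F + (a 1F + 0#)   ≈⟨ +-congˡ (+-identityʳ _) ⟩
    a 0F + a 1F          ∎
  lincomb-generators a 1F = begin
    a 0F * 1# + (a 1F * 0# + (a 2F * 1# + 0#))
      ≈⟨ +-cong (*-identityʳ _) (+-cong (zeroʳ _) (trans (+-identityʳ _) (*-identityʳ _))) ⟩
    a 0F + (0# + a 2F)   ≈⟨ +-congˡ (+-identityˡ _) ⟩
    a 0F + a 2F          ∎
  lincomb-generators a 2F = begin
    a 0F * 1# + (a 1F * 0# + (a 2F * 0# + 0#))
      ≈⟨ +-cong (*-identityʳ _) (+-cong (zeroʳ _) (trans (+-identityʳ _) (zeroʳ _))) ⟩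
    a 0F + (0# + 0#)     ≈⟨ +-congˡ (+-identityʳ _) ⟩
    a 0F + 0#            ≈⟨ +-identityʳ _ ⟩
    a 0F                 ∎

  ∑₃ : ∀ a → ∑ S 3 a ≈ a 0F + (a 1F + a 2F)
  ∑₃ a = +-congˡ (+-congˡ (+-identityʳ (a 2F)))

  ∑₃-determinedBy-lincomb-generators :
    ∀ a b → _≋_ S (lincomb S generators a) (lincomb S generators b) → ∑ S 3 a ≈ ∑ S 3 b
  ∑₃-determinedBy-lincomb-generators a b ga≋gb = begin
    ∑ S 3 a                   ≈⟨ ∑₃ a ⟩
    a 0F + (a 1F + a 2F)      ≈⟨ ∙-cong-via-partials +-commutativeSemigroup
                                   (coordinate 2F) (coordinate 0F) (coordinate 1F) ⟩
    b 0F + (b 1F + b 2F)      ≈⟨ ∑₃ b ⟨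
    ∑ S 3 b                   ∎
    where
    coordinate : ∀ i → ((a 0F + a 1F) ∷ (a 0F + a 2F) ∷ a 0F ∷ []) i
                     ≈ ((b 0F + b 1F) ∷ (b 0F + b 2F) ∷ b 0F ∷ []) i
    coordinate i =
      trans (sym (lincomb-generators a i)) (trans (ga≋gb i) (lincomb-generators b i))

  ∑₃-isLeftLinearOnSpan : IsLeftLinearOnSpan S generators (viaCoefficients generators (∑ S 3))
  ∑₃-isLeftLinearOnSpan = viaCoefficients-isLeftLinearOnSpan generators (∑ S 3)
    ∑₃-determinedBy-lincomb-generators (∑-distrib-⊕ 3) (λ s a → sym (*-distribˡ-∑ 3 s a))

  generators-decomposition :
    _≋_ S (generators 0F) (_⊕_ S (generators 1F) (_⊕_ S (generators 2F) (0# ∷ 0# ∷ 1# ∷ [])))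
  generators-decomposition 0F = sym (trans (+-congˡ (+-identityʳ 0#)) (+-identityʳ 1#))
  generators-decomposition 1F = sym (trans (+-identityˡ _) (+-identityʳ 1#))
  generators-decomposition 2F = sym (trans (+-identityˡ _) (+-identityˡ 1#))

  extension⇒1+1+φ₀[e₂]≈1 :
    (φ₀ : Vecⁿ S 3 → Carrier) → IsLeftLinear S φ₀ →
    (∀ x (p : _∈Span_ S x generators) → φ₀ x ≈ viaCoefficients generators (∑ S 3) x p) →
    (1# + 1#) + φ₀ (0# ∷ 0# ∷ 1# ∷ []) ≈ 1#
  extension⇒1+1+φ₀[e₂]≈1 φ₀ φ₀-linear φ₀-extends = begin
    (1# + 1#) + φ₀ e₂                   ≈⟨ +-assoc 1# 1# (φ₀ e₂) ⟩
    1# + (1# + φ₀ e₂)                   ≈⟨ +-cong (φ₀-generator 1F) (+-congʳ (φ₀-generator 2F)) ⟨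
    φ₀ g₁ + (φ₀ g₂ + φ₀ e₂)             ≈⟨ +-congˡ (+₀ g₂ e₂) ⟨
    φ₀ g₁ + φ₀ (_⊕_ S g₂ e₂)            ≈⟨ +₀ g₁ (_⊕_ S g₂ e₂) ⟨
    φ₀ (_⊕_ S g₁ (_⊕_ S g₂ e₂))         ≈⟨ cong₀ _ _ generators-decomposition ⟨
    φ₀ g₀                               ≈⟨ φ₀-generator 0F ⟩
    1#                                  ∎
    where
    open IsLeftLinear φ₀-linear
    g₀ g₁ g₂ e₂ : Vecⁿ S 3
    g₀ = generators 0F
    g₁ = generators 1F
    g₂ = generators 2F
    e₂ = 0# ∷ 0# ∷ 1# ∷ []
    φ₀-generator : ∀ j → φ₀ (generators j) ≈ 1#
    φ₀-generator j = trans (φ₀-extends _ (generator∈Span generators j)) (∑-δ j)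

corollary3 : ∀ {c ℓ : Level} (S : Semiring c ℓ) →
    ¬ (Semiring._≈_ S (Semiring.0# S) (Semiring.1# S)) →
    LeftExact S →
    ∃ λ e → Semiring._≈_ S (Semiring._+_ S (Semiring._+_ S (Semiring.1# S) (Semiring.1# S)) e) (Semiring.1# S)
corollary3 S _ leftExact =
  let open Semiring S
      (φ₀ , φ₀-linear , φ₀-extends) = leftExact 3 3 (generators S)
        (viaCoefficients S (generators S) (∑ S 3)) (∑₃-isLeftLinearOnSpan S)
  in φ₀ (0# ∷ 0# ∷ 1# ∷ []) , extension⇒1+1+φ₀[e₂]≈1 S φ₀ φ₀-linear φ₀-extends
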